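{- Let $G_1,G_2$ be graphs of maximum degree at most $\Delta$, where $\Delta\in\{1,2\}$. Then $\chi'_{\mathrm{lst}}(G_1,G_2)\leq\Delta+1$.
   Context: For graphs $G_1,G_2$ (possibly sharing edges) with $F=G_1\cup G_2$, the simultaneous list chromatic index $\chi'_{\mathrm{lst}}(G_1,G_2)$ is the least integer $r$ such that for every assignment of lists $L(e)$ with $|L(e)|\geq r$ for $e\in F$, there is a colouring of $F$ giving each $e$ a colour from $L(e)$ that is proper (no two incident edges share a colour) on each of $G_1$ and $G_2$. -}

module Defs where

open import Data.Nat using (ℕ; _≤_; _+_)
open import Data.Bool using (Bool; true; false; if_then_else_; _∨_)
open import Data.Fin using (Fin)
open import Data.List using (List; map; allFin; length)
open import Data.Nat.ListAction using (sum)
open import Data.List.Membership.Propositional using (_∈_)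
open import Data.List.Relation.Unary.Unique.Propositional using (Unique)
open import Data.Product using (∃; _×_)
open import Relation.Binary.PropositionalEquality using (_≡_; _≢_)

record Graph (n : ℕ) : Set where
  field
    adj   : Fin n → Fin n → Bool
    sym   : ∀ u v → adj u v ≡ adj v u
    irrefl : ∀ v → adj v v ≡ false
open Graph public

degree : ∀ {n} → Graph n → Fin n → ℕ
degree {n} G v = sum (map (λ u → if adj G v u then 1 else 0) (allFin n))

MaxDegreeAtMost : ∀ {n} → Graph n → ℕ → Set
MaxDegreeAtMost G Δ = ∀ v → degree G v ≤ Δ

inUnion : ∀ {n} → Graph n → Graph n → Fin n → Fin n → Bool
inUnion G₁ G₂ u v = adj G₁ u v ∨ adj G₂ u v

-- Colours are natural numbers.  An edge {u,v} is represented by both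
-- ordered pairs (u,v),(v,u); list assignments and colourings are
-- functions on ordered pairs required to be symmetric.
ListAssignment : ℕ → Set
ListAssignment n = Fin n → Fin n → List ℕ

EdgeColouring : ℕ → Set
EdgeColouring n = Fin n → Fin n → ℕ

IsListAssignment : ∀ {n} → Graph n → Graph n → ℕ → ListAssignment n → Set
IsListAssignment G₁ G₂ r L =
  (∀ u v → L u v ≡ L v u) ×
  (∀ u v → inUnion G₁ G₂ u v ≡ true → Unique (L u v) × r ≤ length (L u v))

ProperOn : ∀ {n} → Graph n → EdgeColouring n → Set
ProperOn G c = ∀ u v w → adj G u v ≡ true → adj G u w ≡ true → v ≢ w → c u v ≢ c u w

SimultaneousLColouring : ∀ {n} → Graph n → Graph n → ListAssignment n → EdgeColouring n → Set
SimultaneousLColouring G₁ G₂ L c =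
  (∀ u v → c u v ≡ c v u) ×
  (∀ u v → inUnion G₁ G₂ u v ≡ true → c u v ∈ L u v) ×
  ProperOn G₁ c × ProperOn G₂ c

SimListChromaticIndexAtMost : ∀ {n} → Graph n → Graph n → ℕ → Set
SimListChromaticIndexAtMost {n} G₁ G₂ r =
  (L : ListAssignment n) → IsListAssignment G₁ G₂ r L →
  ∃ λ (c : EdgeColouring n) → SimultaneousLColouring G₁ G₂ L c

{-# OPTIONS --safe #-}
-- Colour the edges of G₁ ∪ G₂ greedily, first those lying in both graphs and
-- then the others.  When an edge e is coloured, every already coloured edge that
-- constrains it is adjacent to e within a single graph G ∈ {G₁, G₂} containing e:
-- this is clear if e lies in only one graph, and if e lies in both then so does
-- every edge coloured before it, so adjacency in G₂ is also adjacency in G₁.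
-- With maximum degree Δ an edge of G is adjacent to at most 2(Δ - 1) others, so
-- lists of length 2Δ - 1 suffice, and 2Δ - 1 ≤ Δ + 1 precisely when Δ ≤ 2.
module Submission where

open import Defs hiding (sym)
open import Data.Nat using (ℕ; _+_; suc; _≤_; _<_; z≤n; s≤s)
import Data.Nat as Nat
open import Data.Nat.Properties using (≤-trans; <-≤-trans; ≤-pred; +-mono-≤)
open import Data.Nat.ListAction using (sum)
open import Data.Sum using (_⊎_; inj₁; inj₂; [_,_]′)
import Data.Sum as Sum
open import Relation.Binary.PropositionalEquality
  using (_≡_; _≢_; refl; sym; trans; cong; cong₂; subst; ≢-sym)

open import Data.Bool using (Bool; true; false; if_then_else_; _∨_; _∧_)
import Data.Bool as Bool
open import Data.Bool.Properties using (∨-zeroʳ; ∧-conicalˡ)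
open import Data.Empty using (⊥-elim)
open import Data.Fin using (Fin)
import Data.Fin.Properties as Fin
open import Data.List using (List; []; _∷_; _++_; map; filter; length; allFin; cartesianProduct)
open import Data.List.Properties using (filter-notAll; length-++; length-map)
open import Data.List.Membership.Propositional using (_∈_; _∉_)
open import Data.List.Membership.Propositional.Properties
  using (∈-filter⁺; ∈-filter⁻; ∈-map⁺; ∈-++⁺ˡ; ∈-++⁺ʳ; ∈-++⁻; ∈-allFin; ∈-cartesianProduct⁺)
import Data.List.Membership.DecPropositional as DecMembership
open import Data.List.Relation.Unary.Any using (here; there)
import Data.List.Relation.Unary.Any as Any
open import Data.List.Relation.Unary.All using (All; []; _∷_)
import Data.List.Relation.Unary.All as All
open import Data.List.Relation.Unary.All.Properties using (all-filter)
open import Data.List.Relation.Unary.AllPairs using (AllPairs; []; _∷_)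
import Data.List.Relation.Unary.AllPairs as AllPairs
open import Data.List.Relation.Unary.Unique.Propositional using (Unique)
open import Data.Product using (∃; _×_; _,_; proj₁; proj₂; uncurry)
import Data.Product as Product
open import Data.Product.Properties using (≡-dec)
open import Function using (_∘_)
open import Level using (0ℓ)
open import Relation.Binary.Core using (Rel)
open import Relation.Binary.Definitions using (DecidableEquality; Symmetric)
open import Relation.Nullary using (yes; no; ¬?; contradiction)

∈-∷⁻-≢ : ∀ {A : Set} {x y : A} {xs} → x ∈ y ∷ xs → x ≢ y → x ∈ xs
∈-∷⁻-≢ (here x≡y)  x≢y = contradiction x≡y x≢y
∈-∷⁻-≢ (there x∈xs) _  = x∈xs

module _ {A : Set} (_≟_ : DecidableEquality A) where
  open DecMembership _≟_ using (_∈?_)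

  unique-longer⇒∃∉ : ∀ {xs ys : List A} → Unique xs → length ys < length xs →
                     ∃ λ x → x ∈ xs × x ∉ ys
  unique-longer⇒∃∉ {x ∷ xs} {ys} (x∉xs ∷ xs!) |ys|≤|xs| with x ∈? ys
  ... | no x∉ys = x , here refl , x∉ys
  ... | yes x∈ys
    with z , z∈xs , z∉ys-x ← unique-longer⇒∃∉ {ys = filter (λ y → ¬? (y ≟ x)) ys} xs!
           (<-≤-trans (filter-notAll _ ys (Any.map (λ x≡y y≢x → y≢x (sym x≡y)) x∈ys))
                      (≤-pred |ys|≤|xs|))
    = z , there z∈xs , λ z∈ys → z∉ys-x (∈-filter⁺ _ z∈ys (≢-sym (All.lookup x∉xs z∈xs)))

length-filter≡sum-if : ∀ {A : Set} (b : A → Bool) xs →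
  length (filter (λ x → b x Bool.≟ true) xs) ≡ sum (map (λ x → if b x then 1 else 0) xs)
length-filter≡sum-if b [] = refl
length-filter≡sum-if b (x ∷ xs) with b x
... | true  = cong suc (length-filter≡sum-if b xs)
... | false = length-filter≡sum-if b xs

module _ {A : Set} {R : Rel A 0ℓ} where

  AllPairs-++⁺-ends : ∀ {xs ys} → All (λ x → ∀ y → R x y) xs → All (λ y → ∀ x → R x y) ys →
                  AllPairs R (xs ++ ys)
  AllPairs-++⁺-ends (Rx ∷ Rxs) Rys        = All.tabulate (λ {y} _ → Rx y) ∷ AllPairs-++⁺-ends Rxs Rys
  AllPairs-++⁺-ends []         []         = []
  AllPairs-++⁺-ends []         (_ ∷ Rys)  = All.map (λ Rz → Rz _) Rys ∷ AllPairs-++⁺-ends [] Rys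

module _ {A : Set} (b : A → Bool) where

  falsesThenTrues : List A → List A
  falsesThenTrues xs = filter (λ x → b x Bool.≟ false) xs ++ filter (λ x → b x Bool.≟ true) xs

  ∈-falsesThenTrues⁺ : ∀ {x xs} → x ∈ xs → x ∈ falsesThenTrues xs
  ∈-falsesThenTrues⁺ {x} {xs} x∈xs with b x in bx
  ... | false = ∈-++⁺ˡ (∈-filter⁺ _ x∈xs bx)
  ... | true  = ∈-++⁺ʳ _ (∈-filter⁺ _ x∈xs bx)

  ∈-falsesThenTrues⁻ : ∀ {x} xs → x ∈ falsesThenTrues xs → x ∈ xs
  ∈-falsesThenTrues⁻ xs x∈ with ∈-++⁻ (filter (λ x → b x Bool.≟ false) xs) x∈
  ... | inj₁ x∈falses = proj₁ (∈-filter⁻ _ x∈falses)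
  ... | inj₂ x∈trues  = proj₁ (∈-filter⁻ _ x∈trues)

  falsesThenTrues-sorted : ∀ xs → AllPairs (λ x y → b x ≡ true → b y ≡ true) (falsesThenTrues xs)
  falsesThenTrues-sorted xs = AllPairs-++⁺-ends
    (All.map (λ bx≡false _ bx≡true → contradiction (trans (sym bx≡false) bx≡true) λ ())
             (all-filter _ xs))
    (All.map (λ by≡true _ _ → by≡true) (all-filter _ xs))

module Greedy {E : Set} (_≟_ : DecidableEquality E)
  (_#_ : Rel E 0ℓ) (#-sym : Symmetric _#_) (#⇒≢ : ∀ {e f} → e # f → e ≢ f)
  (L : E → List ℕ) (blockers : E → List E) where

  IsListColouring : List E → (E → ℕ) → Set
  IsListColouring es col =
    (∀ {e} → e ∈ es → col e ∈ L e) × (∀ {e f} → e ∈ es → f ∈ es → e # f → col e ≢ col f)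

  -- The list is coloured from its last element back to its first.
  greedyColouring : ∀ es → All (λ e → Unique (L e) × length (blockers e) < length (L e)) es →
                    AllPairs (λ e f → e # f → f ∈ blockers e) es →
                    ∃ λ col → IsListColouring es col
  greedyColouring [] [] [] = (λ _ → 0) , (λ ()) , λ ()
  greedyColouring (e ∷ es) ((L! , short) ∷ ok) (e-blocks ∷ sorted)
    with col , inL , proper ← greedyColouring es ok sorted
    with x , x∈L , x-unused ← unique-longer⇒∃∉ Nat._≟_ {ys = map col (blockers e)} L!
                                (subst (_< length (L e)) (sym (length-map col (blockers e))) short)
    = col′ , inL′ , proper′
    where
    col′ : E → ℕ
    col′ g with g ≟ e
    ... | yes _ = x
    ... | no  _ = col g

    x-fresh : ∀ {f} → f ∈ es → e # f → col f ≢ x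
    x-fresh f∈es e#f colf≡x =
      x-unused (subst (_∈ map col (blockers e)) colf≡x (∈-map⁺ col (All.lookup e-blocks f∈es e#f)))

    inL′ : ∀ {g} → g ∈ e ∷ es → col′ g ∈ L g
    inL′ {g} g∈ with g ≟ e
    ... | yes refl = x∈L
    ... | no  g≢e  = inL (∈-∷⁻-≢ g∈ g≢e)

    proper′ : ∀ {g h} → g ∈ e ∷ es → h ∈ e ∷ es → g # h → col′ g ≢ col′ h
    proper′ {g} {h} g∈ h∈ g#h with g ≟ e | h ≟ e
    ... | yes refl | yes refl = contradiction refl (#⇒≢ g#h)
    ... | yes refl | no  h≢e  = x-fresh (∈-∷⁻-≢ h∈ h≢e) g#h ∘ sym
    ... | no  g≢e  | yes refl = x-fresh (∈-∷⁻-≢ g∈ g≢e) (#-sym g#h)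
    ... | no  g≢e  | no  h≢e  = proper (∈-∷⁻-≢ g∈ g≢e) (∈-∷⁻-≢ h∈ h≢e) g#h

module _ {n : ℕ} where

  Edge : Set
  Edge = Fin n × Fin n

  _≟ᴱ_ : DecidableEquality Edge
  _≟ᴱ_ = ≡-dec Fin._≟_ Fin._≟_

  edge : Fin n → Fin n → Edge
  edge u v with u Fin.≤? v
  ... | yes _ = u , v
  ... | no  _ = v , u

  edge-cases : ∀ u v → edge u v ≡ (u , v) ⊎ edge u v ≡ (v , u)
  edge-cases u v with u Fin.≤? v
  ... | yes _ = inj₁ refl
  ... | no  _ = inj₂ refl

  edge-sym : ∀ u v → edge u v ≡ edge v u
  edge-sym u v with u Fin.≤? v | v Fin.≤? u
  ... | yes u≤v | yes v≤u rewrite Fin.≤-antisym u≤v v≤u = refl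
  ... | yes _   | no  _   = refl
  ... | no  _   | yes _   = refl
  ... | no  u≰v | no  v≰u = ⊥-elim ([ u≰v , v≰u ]′ (Fin.≤-total u v))

  edge-injectiveʳ : ∀ {u v w} → edge u v ≡ edge u w → v ≡ w
  edge-injectiveʳ {u} {v} {w} eq with edge u v | edge-cases u v | edge u w | edge-cases u w | eq
  ... | _ | inj₁ refl | _ | inj₁ refl | refl = refl
  ... | _ | inj₁ refl | _ | inj₂ refl | refl = refl
  ... | _ | inj₂ refl | _ | inj₁ refl | refl = refl
  ... | _ | inj₂ refl | _ | inj₂ refl | refl = refl

  uncurry-edge : ∀ {A : Set} (f : Fin n → Fin n → A) → (∀ u v → f u v ≡ f v u) →
                 ∀ u v → uncurry f (edge u v) ≡ f u v
  uncurry-edge f f-sym u v with edge u v | edge-cases u v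
  ... | _ | inj₁ refl = refl
  ... | _ | inj₂ refl = f-sym v u

  module _ (G : Graph n) where

    isEdge : Edge → Bool
    isEdge = uncurry (adj G)

    isEdge-edge : ∀ u v → isEdge (edge u v) ≡ adj G u v
    isEdge-edge = uncurry-edge (adj G) (Graph.sym G)

    neighbours : Fin n → List (Fin n)
    neighbours u = filter (λ w → adj G u w Bool.≟ true) (allFin n)

    neighboursExcept : Fin n → Fin n → List (Fin n)
    neighboursExcept u v = filter (λ w → ¬? (w Fin.≟ v)) (neighbours u)

    ∈-neighbours : ∀ {u w} → adj G u w ≡ true → w ∈ neighbours u
    ∈-neighbours {w = w} uw = ∈-filter⁺ _ (∈-allFin w) uw

    ∈-neighboursExcept : ∀ {u v w} → adj G u w ≡ true → w ≢ v → w ∈ neighboursExcept u v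
    ∈-neighboursExcept uw w≢v = ∈-filter⁺ _ (∈-neighbours uw) w≢v

    length-neighboursExcept : ∀ {k u v} → MaxDegreeAtMost G (suc k) → adj G u v ≡ true →
                              length (neighboursExcept u v) ≤ k
    length-neighboursExcept {k} {u} {v} Δ≤1+k uv = ≤-pred (<-≤-trans
      (filter-notAll _ (neighbours u) (Any.map (λ v≡w w≢v → w≢v (sym v≡w)) (∈-neighbours uv)))
      (subst (_≤ suc k) (sym (length-filter≡sum-if (adj G u) (allFin n))) (Δ≤1+k u)))

    adjacentEdges : Edge → List Edge
    adjacentEdges (a , b) = map (edge a) (neighboursExcept a b) ++ map (edge b) (neighboursExcept b a)

    length-adjacentEdges : ∀ {k} e → MaxDegreeAtMost G (suc k) → isEdge e ≡ true →
                           length (adjacentEdges e) ≤ k + k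
    length-adjacentEdges (a , b) Δ≤1+k ab
      rewrite length-++ (map (edge a) (neighboursExcept a b)) {map (edge b) (neighboursExcept b a)}
            | length-map (edge a) (neighboursExcept a b) | length-map (edge b) (neighboursExcept b a)
      = +-mono-≤ (length-neighboursExcept Δ≤1+k ab)
                 (length-neighboursExcept Δ≤1+k (trans (Graph.sym G b a) ab))

    data Adjacent : Edge → Edge → Set where
      shareEnd : ∀ {u v w} → adj G u v ≡ true → adj G u w ≡ true → v ≢ w →
                 Adjacent (edge u v) (edge u w)

    Adjacent-sym : Symmetric Adjacent
    Adjacent-sym (shareEnd uv uw v≢w) = shareEnd uw uv (≢-sym v≢w)

    Adjacent⇒≢ : ∀ {e f} → Adjacent e f → e ≢ f
    Adjacent⇒≢ (shareEnd _ _ v≢w) = v≢w ∘ edge-injectiveʳ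

    Adjacent⇒isEdgeˡ : ∀ {e f} → Adjacent e f → isEdge e ≡ true
    Adjacent⇒isEdgeˡ (shareEnd {u} {v} uv _ _) = trans (isEdge-edge u v) uv

    ∈-adjacentEdges : ∀ {e f} → Adjacent e f → f ∈ adjacentEdges e
    ∈-adjacentEdges (shareEnd {u} {v} {w} _ uw v≢w) with edge u v | edge-cases u v
    ... | _ | inj₁ refl = ∈-++⁺ˡ (∈-map⁺ (edge u) (∈-neighboursExcept uw (≢-sym v≢w)))
    ... | _ | inj₂ refl = ∈-++⁺ʳ _ (∈-map⁺ (edge u) (∈-neighboursExcept uw (≢-sym v≢w)))

  Adjacent-transfer : ∀ {G H e f} → Adjacent G e f → isEdge H e ≡ true → isEdge H f ≡ true →
                      Adjacent H e f
  Adjacent-transfer {H = H} (shareEnd {u} {v} {w} _ _ v≢w) e∈H f∈H =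
    shareEnd (trans (sym (isEdge-edge H u v)) e∈H) (trans (sym (isEdge-edge H u w)) f∈H) v≢w

module _ {n : ℕ} (G₁ G₂ : Graph n) where

  Conflict : Rel Edge 0ℓ
  Conflict e f = Adjacent G₁ e f ⊎ Adjacent G₂ e f

  Conflict-sym : Symmetric Conflict
  Conflict-sym = Sum.map (Adjacent-sym G₁) (Adjacent-sym G₂)

  Conflict⇒≢ : ∀ {e f} → Conflict e f → e ≢ f
  Conflict⇒≢ = [ Adjacent⇒≢ G₁ , Adjacent⇒≢ G₂ ]′

  inBoth : Edge → Bool
  inBoth e = isEdge G₁ e ∧ isEdge G₂ e

  blockers : Edge → List Edge
  blockers e = if isEdge G₁ e then adjacentEdges G₁ e else adjacentEdges G₂ e

  ∈-blockers : ∀ {e f} → (inBoth e ≡ true → inBoth f ≡ true) → Conflict e f → f ∈ blockers e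
  ∈-blockers {e} e⇒f c with isEdge G₁ e in e∈G₁ | c
  ... | true  | inj₁ adj₁ = ∈-adjacentEdges G₁ adj₁
  ... | true  | inj₂ adj₂ = ∈-adjacentEdges G₁
        (Adjacent-transfer adj₂ e∈G₁ (∧-conicalˡ _ _ (e⇒f (Adjacent⇒isEdgeˡ G₂ adj₂))))
  ... | false | inj₁ adj₁ = contradiction (trans (sym e∈G₁) (Adjacent⇒isEdgeˡ G₁ adj₁)) λ ()
  ... | false | inj₂ adj₂ = ∈-adjacentEdges G₂ adj₂

  length-blockers : ∀ {k} → MaxDegreeAtMost G₁ (suc k) → MaxDegreeAtMost G₂ (suc k) →
                    ∀ e → isEdge G₁ e ∨ isEdge G₂ e ≡ true → length (blockers e) ≤ k + k
  length-blockers Δ₁≤1+k Δ₂≤1+k e e∈F with isEdge G₁ e in e∈G₁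
  ... | true  = length-adjacentEdges G₁ e Δ₁≤1+k e∈G₁
  ... | false = length-adjacentEdges G₂ e Δ₂≤1+k e∈F

  unionPairs : List Edge
  unionPairs =
    filter (λ e → uncurry (inUnion G₁ G₂) e Bool.≟ true) (cartesianProduct (allFin n) (allFin n))

  singlesThenDoubles : List Edge
  singlesThenDoubles = falsesThenTrues inBoth unionPairs

  edge∈singlesThenDoubles : ∀ {u v} → inUnion G₁ G₂ u v ≡ true → edge u v ∈ singlesThenDoubles
  edge∈singlesThenDoubles {u} {v} uv∈F = ∈-falsesThenTrues⁺ inBoth
    (∈-filter⁺ _ (∈-cartesianProduct⁺ (∈-allFin _) (∈-allFin _))
      (trans (uncurry-edge (inUnion G₁ G₂) inUnion-sym u v) uv∈F))
    where
    inUnion-sym : ∀ u v → inUnion G₁ G₂ u v ≡ inUnion G₁ G₂ v u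
    inUnion-sym u v = cong₂ _∨_ (Graph.sym G₁ u v) (Graph.sym G₂ u v)

  singlesThenDoubles⊆F : ∀ {e} → e ∈ singlesThenDoubles → isEdge G₁ e ∨ isEdge G₂ e ≡ true
  singlesThenDoubles⊆F e∈ = proj₂ (∈-filter⁻ _ {xs = cartesianProduct (allFin n) (allFin n)}
                                              (∈-falsesThenTrues⁻ inBoth unionPairs e∈))

  singlesThenDoubles-sorted : AllPairs (λ e f → Conflict e f → f ∈ blockers e) singlesThenDoubles
  singlesThenDoubles-sorted = AllPairs.map ∈-blockers (falsesThenTrues-sorted inBoth unionPairs)

  inUnion-fromˡ : ∀ {u v} → adj G₁ u v ≡ true → inUnion G₁ G₂ u v ≡ true
  inUnion-fromˡ {u} {v} uv = cong (_∨ adj G₂ u v) uv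

  inUnion-fromʳ : ∀ {u v} → adj G₂ u v ≡ true → inUnion G₁ G₂ u v ≡ true
  inUnion-fromʳ {u} {v} uv = trans (cong (adj G₁ u v ∨_) uv) (∨-zeroʳ _)

  open module GreedyOnEdges (L : ListAssignment n) =
    Greedy _≟ᴱ_ Conflict Conflict-sym Conflict⇒≢ (uncurry L) blockers

  simultaneous-of-listColouring : ∀ L → (∀ u v → L u v ≡ L v u) →
    ∀ {col} → IsListColouring L singlesThenDoubles col →
    SimultaneousLColouring G₁ G₂ L (λ u v → col (edge u v))
  simultaneous-of-listColouring L L-sym {col} (inL , proper) =
    (λ u v → cong col (edge-sym u v)) , inL′ , proper-on inj₁ inUnion-fromˡ , proper-on inj₂ inUnion-fromʳ
    where
    inL′ : ∀ u v → inUnion G₁ G₂ u v ≡ true → col (edge u v) ∈ L u v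
    inL′ u v uv∈F =
      subst (col (edge u v) ∈_) (uncurry-edge L L-sym u v) (inL (edge∈singlesThenDoubles uv∈F))

    proper-on : ∀ {G} → (∀ {e f} → Adjacent G e f → Conflict e f) →
                (∀ {u v} → adj G u v ≡ true → inUnion G₁ G₂ u v ≡ true) →
                ProperOn G (λ u v → col (edge u v))
    proper-on Adjacent⇒Conflict G⊆F u v w uv uw v≢w =
      proper (edge∈singlesThenDoubles (G⊆F uv)) (edge∈singlesThenDoubles (G⊆F uw))
             (Adjacent⇒Conflict (shareEnd uv uw v≢w))

  simListChromaticIndexAtMost-2Δ-1 : ∀ {k} →
    MaxDegreeAtMost G₁ (suc k) → MaxDegreeAtMost G₂ (suc k) →
    SimListChromaticIndexAtMost G₁ G₂ (suc (k + k))
  simListChromaticIndexAtMost-2Δ-1 Δ₁≤1+k Δ₂≤1+k L (L-sym , L-ok) =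
    let col , colouring =
          greedyColouring L singlesThenDoubles listsLongEnough singlesThenDoubles-sorted
    in (λ u v → col (edge u v)) , simultaneous-of-listColouring L L-sym colouring
    where
    listsLongEnough : All (λ e → Unique (uncurry L e) × length (blockers e) < length (uncurry L e))
                          singlesThenDoubles
    listsLongEnough = All.tabulate λ {e} e∈ → Product.map₂
      (≤-trans (s≤s (length-blockers Δ₁≤1+k Δ₂≤1+k e (singlesThenDoubles⊆F e∈))))
      (L-ok (proj₁ e) (proj₂ e) (singlesThenDoubles⊆F e∈))

simListChromaticIndexAtMost-mono : ∀ {n} (G₁ G₂ : Graph n) {r s} → r ≤ s →
  SimListChromaticIndexAtMost G₁ G₂ r → SimListChromaticIndexAtMost G₁ G₂ s
simListChromaticIndexAtMost-mono _ _ r≤s χ′≤r L (L-sym , L-ok) =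
  χ′≤r L (L-sym , λ u v uv∈F → Product.map₂ (≤-trans r≤s) (L-ok u v uv∈F))

proposition5p1 : (n Δ : ℕ) → Δ ≡ 1 ⊎ Δ ≡ 2 → (G₁ G₂ : Graph n) →
    MaxDegreeAtMost G₁ Δ → MaxDegreeAtMost G₂ Δ →
    SimListChromaticIndexAtMost G₁ G₂ (Δ + 1)
proposition5p1 n .1 (inj₁ refl) G₁ G₂ Δ₁≤1 Δ₂≤1 =
  simListChromaticIndexAtMost-mono G₁ G₂ (s≤s z≤n) (simListChromaticIndexAtMost-2Δ-1 G₁ G₂ Δ₁≤1 Δ₂≤1)
proposition5p1 n .2 (inj₂ refl) G₁ G₂ Δ₁≤2 Δ₂≤2 = simListChromaticIndexAtMost-2Δ-1 G₁ G₂ Δ₁≤2 Δ₂≤2
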